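{- Let $n\ge1$, let $P\in\mathcal{C}(G_n)$, and let $S$ be a nonempty proper subset of $Q_n$. Then $S$ and $Q_n-S$ are not both separable with respect to $P$.
   Context: Let $Q_n=\{1,\dots,n\}$. An outcome on $S\subseteq Q_n$ is an element of $\{0,1\}^S$. A preference matrix on $Q_n$ is a $2^n\times n$ $0/1$ matrix whose rows are exactly the $2^n$ elements of $\{0,1\}^n$, each once. For nonempty proper $S\subset Q_n$ and outcome $x$ on $Q_n-S$, $P^{[Q_n-S,x]}$ is the matrix of rows of $P$ whose entries on the columns $Q_n-S$ equal $x$, in their original order, restricted to the columns in $S$. $S$ is separable w.r.t. $P$ if $P^{[Q_n-S,x]}=P^{[Q_n-S,y]}$ for all outcomes $x,y$ on $Q_n-S$. $\mathcal{C}(G_n)$ is the set of preference matrices on $Q_n$ in which consecutive rows differ in exactly one coordinate. -}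

module Defs where

open import Data.Nat using (ℕ; zero; suc; _^_; _+_)
open import Data.Bool using (Bool; true; false; _∧_; _xor_; not; if_then_else_)
open import Data.Vec using (Vec; []; _∷_)
open import Data.List using (List; []; _∷_; length; filterᵇ; map)
open import Data.List.Relation.Unary.Unique.Propositional using (Unique)
open import Data.List.Relation.Unary.Linked using (Linked)
open import Data.List.Membership.Propositional using (_∈_)
open import Data.Fin.Subset using (Subset; ∁)
open import Data.Product using (_×_)
open import Relation.Binary.PropositionalEquality using (_≡_)

-- Q_n = Fin n.  An outcome on Q_n is a vector Vec Bool n (false = 0, true = 1).
Outcome : ℕ → Set
Outcome n = Vec Bool n

-- A preference matrix on Q_n: its list of rows (top to bottom), of length 2^n,
-- containing every outcome on Q_n exactly once.
record PrefMatrix (n : ℕ) : Set where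
  field
    rows     : List (Outcome n)
    length≡  : length rows ≡ 2 ^ n
    unique   : Unique rows
    complete : (v : Outcome n) → v ∈ rows

open PrefMatrix public

hamming : ∀ {n} → Outcome n → Outcome n → ℕ
hamming [] [] = 0
hamming (a ∷ u) (b ∷ v) = (if a xor b then 1 else 0) + hamming u v

Adjacent : ∀ {n} → Outcome n → Outcome n → Set
Adjacent u v = hamming u v ≡ 1

InCG : ∀ {n} → PrefMatrix n → Set
InCG P = Linked Adjacent (rows P)

restrict : ∀ {n} → Subset n → Outcome n → List Bool
restrict [] [] = []
restrict (true  ∷ S) (b ∷ v) = b ∷ restrict S v
restrict (false ∷ S) (b ∷ v) = restrict S v

agreeOff : ∀ {n} → Subset n → Outcome n → Outcome n → Bool
agreeOff [] [] [] = true
agreeOff (true  ∷ S) (_ ∷ x) (_ ∷ r) = agreeOff S x r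
agreeOff (false ∷ S) (a ∷ x) (b ∷ r) =
  not (a xor b) ∧ agreeOff S x r

-- P^{[Q_n - S, x|_{Q_n - S}]}: rows of P agreeing with x off S, in order,
-- restricted to the columns in S.  (Only the values of x outside S matter.)
subMatrix : ∀ {n} → PrefMatrix n → Subset n → Outcome n → List (List Bool)
subMatrix P S x = map (restrict S) (filterᵇ (agreeOff S x) (rows P))

Separable : ∀ {n} → Subset n → PrefMatrix n → Set
Separable {n} S P = (x y : Outcome n) → subMatrix P S x ≡ subMatrix P S y

-- Group the rows of P into blocks according to their values outside S;
-- separability of S says that all blocks, read top to bottom and restricted
-- to S, are the same list.  The first two rows r₀, r₁ differ in one column,
-- so they lie in a common block of S or of Q_n − S; say of S.  Walk down P
-- from r₁ to the first row y outside the block of r₀.  Its predecessor c lies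
-- in that block and c ≠ r₀, so c differs from r₀ on S, while y differs from c
-- only outside S.  Hence y heads its own block with a restriction to S other
-- than that of r₀, which heads the block of r₀: S is not separable.
module Submission where

open import Defs
open import Data.Nat using (ℕ; _≤_)
open import Data.Nat.Properties using (suc-injective)
open import Data.Bool using (Bool; true; false; not; T)
import Data.Bool as Bool
open import Data.Empty using (⊥-elim)
open import Data.Bool.Properties using (not-involutive)
open import Data.Fin using (Fin)
open import Data.Fin.Subset using (Subset; ∁; Nonempty; _∈_)
open import Data.Product using (_×_; _,_; ∃)
open import Data.Sum using (_⊎_; inj₁; inj₂)
open import Data.Vec using ([]; _∷_; _[_]%=_; replicate; here; there)
open import Data.List using (List; []; _∷_; map; filterᵇ)
open import Data.List.Properties using (∷-injective; ∷-injectiveˡ; ∷-injectiveʳ; ≡-dec; filter-accept; filter-reject)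
open import Data.List.Relation.Unary.All using (All; _∷_)
import Data.List.Relation.Unary.Any as Any
open import Data.List.Relation.Unary.Linked using (Linked; _∷_)
import Data.List.Relation.Unary.Linked as Linked
open import Data.List.Relation.Unary.Unique.Propositional using (Unique; _∷_)
import Data.List.Membership.Propositional as List
open import Function using (_∘_)
open import Relation.Binary.PropositionalEquality using (_≡_; _≢_; refl; sym; trans; cong; cong₂; subst; module ≡-Reasoning)
open import Relation.Nullary using (¬_; yes; no)
open import Relation.Nullary.Decidable using (T?)

private
  variable
    n : ℕ

hamming≡0⇒≡ : {u v : Outcome n} → hamming u v ≡ 0 → u ≡ v
hamming≡0⇒≡ {u = []}       {[]}        _ = refl
hamming≡0⇒≡ {u = true ∷ u}  {true ∷ v}  e = cong (true ∷_) (hamming≡0⇒≡ e)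
hamming≡0⇒≡ {u = false ∷ u} {false ∷ v} e = cong (false ∷_) (hamming≡0⇒≡ e)

∁-involutive : (S : Subset n) → ∁ (∁ S) ≡ S
∁-involutive []      = refl
∁-involutive (s ∷ S) = cong₂ _∷_ (not-involutive s) (∁-involutive S)

restrict-injective : (S : Subset n) {u v : Outcome n} →
  restrict S u ≡ restrict S v → restrict (∁ S) u ≡ restrict (∁ S) v → u ≡ v
restrict-injective []          {[]}    {[]}    _  _  = refl
restrict-injective (true ∷ S)  {a ∷ u} {b ∷ v} eS eT =
  cong₂ _∷_ (∷-injectiveˡ eS) (restrict-injective S (∷-injectiveʳ eS) eT)
restrict-injective (false ∷ S) {a ∷ u} {b ∷ v} eS eT =
  cong₂ _∷_ (∷-injectiveˡ eT) (restrict-injective S eS (∷-injectiveʳ eT))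

∷-restrict≡⊎restrict∁≡ : (s : Bool) (S : Subset n) (a : Bool) {u v : Outcome n} →
  restrict S u ≡ restrict S v ⊎ restrict (∁ S) u ≡ restrict (∁ S) v →
  restrict (s ∷ S) (a ∷ u) ≡ restrict (s ∷ S) (a ∷ v) ⊎
  restrict (∁ (s ∷ S)) (a ∷ u) ≡ restrict (∁ (s ∷ S)) (a ∷ v)
∷-restrict≡⊎restrict∁≡ true  S a (inj₁ eS) = inj₁ (cong (a ∷_) eS)
∷-restrict≡⊎restrict∁≡ true  S a (inj₂ eT) = inj₂ eT
∷-restrict≡⊎restrict∁≡ false S a (inj₁ eS) = inj₁ eS
∷-restrict≡⊎restrict∁≡ false S a (inj₂ eT) = inj₂ (cong (a ∷_) eT)

adjacent⇒restrict≡⊎restrict∁≡ : (S : Subset n) {u v : Outcome n} → Adjacent u v →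
  restrict S u ≡ restrict S v ⊎ restrict (∁ S) u ≡ restrict (∁ S) v
adjacent⇒restrict≡⊎restrict∁≡ [] {[]} {[]} ()
adjacent⇒restrict≡⊎restrict∁≡ (s ∷ S) {true ∷ u}  {true ∷ v}  e =
  ∷-restrict≡⊎restrict∁≡ s S true (adjacent⇒restrict≡⊎restrict∁≡ S e)
adjacent⇒restrict≡⊎restrict∁≡ (s ∷ S) {false ∷ u} {false ∷ v} e =
  ∷-restrict≡⊎restrict∁≡ s S false (adjacent⇒restrict≡⊎restrict∁≡ S e)
adjacent⇒restrict≡⊎restrict∁≡ (true ∷ S)  {true ∷ u}  {false ∷ v} e =
  inj₂ (cong (restrict (∁ S)) (hamming≡0⇒≡ (suc-injective e)))
adjacent⇒restrict≡⊎restrict∁≡ (false ∷ S) {true ∷ u}  {false ∷ v} e =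
  inj₁ (cong (restrict S) (hamming≡0⇒≡ (suc-injective e)))
adjacent⇒restrict≡⊎restrict∁≡ (true ∷ S)  {false ∷ u} {true ∷ v}  e =
  inj₂ (cong (restrict (∁ S)) (hamming≡0⇒≡ (suc-injective e)))
adjacent⇒restrict≡⊎restrict∁≡ (false ∷ S) {false ∷ u} {true ∷ v}  e =
  inj₁ (cong (restrict S) (hamming≡0⇒≡ (suc-injective e)))

flipAt : Outcome n → Fin n → Outcome n
flipAt u i = u [ i ]%= not

restrict-flipAt : {S : Subset n} {i : Fin n} (u : Outcome n) → i ∈ S →
  restrict S u ≢ restrict S (flipAt u i)
restrict-flipAt {S = true ∷ S} (true ∷ u)  here      = λ ()
restrict-flipAt {S = true ∷ S} (false ∷ u) here      = λ ()
restrict-flipAt {S = true ∷ S} (a ∷ u)     (there p) = restrict-flipAt u p ∘ ∷-injectiveʳ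
restrict-flipAt {S = false ∷ S} (a ∷ u)    (there p) = restrict-flipAt u p

agreeOff⇒restrict∁≡ : (S : Subset n) {u v : Outcome n} →
  T (agreeOff S u v) → restrict (∁ S) u ≡ restrict (∁ S) v
agreeOff⇒restrict∁≡ []          {[]}        {[]}        _ = refl
agreeOff⇒restrict∁≡ (true ∷ S)  {_ ∷ u}     {_ ∷ v}     t = agreeOff⇒restrict∁≡ S t
agreeOff⇒restrict∁≡ (false ∷ S) {true ∷ u}  {true ∷ v}  t = cong (true ∷_) (agreeOff⇒restrict∁≡ S t)
agreeOff⇒restrict∁≡ (false ∷ S) {false ∷ u} {false ∷ v} t = cong (false ∷_) (agreeOff⇒restrict∁≡ S t)

restrict∁≡⇒agreeOff : (S : Subset n) {u v : Outcome n} →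
  restrict (∁ S) u ≡ restrict (∁ S) v → T (agreeOff S u v)
restrict∁≡⇒agreeOff []          {[]}    {[]}    _ = _
restrict∁≡⇒agreeOff (true ∷ S)  {_ ∷ u} {_ ∷ v} e = restrict∁≡⇒agreeOff S e
restrict∁≡⇒agreeOff (false ∷ S) {a ∷ u} {b ∷ v} e with ∷-injective e
... | refl , e′ with a
...   | true  = restrict∁≡⇒agreeOff S e′
...   | false = restrict∁≡⇒agreeOff S e′

block : Subset n → Outcome n → List (Outcome n) → List (Outcome n)
block S x = filterᵇ (agreeOff S x)

SeparableRows : Subset n → List (Outcome n) → Set
SeparableRows {n} S rs = (x y : Outcome n) → map (restrict S) (block S x rs) ≡ map (restrict S) (block S y rs)

module _ (S : Subset n) where

  block-accept : {y x : Outcome n} {xs : List (Outcome n)} →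
    restrict (∁ S) y ≡ restrict (∁ S) x → block S y (x ∷ xs) ≡ x ∷ block S y xs
  block-accept {y} e = filter-accept (T? ∘ agreeOff S y) (restrict∁≡⇒agreeOff S e)

  block-reject : {y x : Outcome n} {xs : List (Outcome n)} →
    restrict (∁ S) y ≢ restrict (∁ S) x → block S y (x ∷ xs) ≡ block S y xs
  block-reject {y} ne = filter-reject (T? ∘ agreeOff S y) (ne ∘ agreeOff⇒restrict∁≡ S)

  module _ (r₀ : Outcome n) where

    private
      R K : Outcome n → List Bool
      R = restrict S
      K = restrict (∁ S)

    ∈-tail-outsideBlock : {c w : Outcome n} {l : List (Outcome n)} →
      K c ≡ K r₀ → K w ≢ K r₀ → w List.∈ c ∷ l → w List.∈ l
    ∈-tail-outsideBlock Kc Kw (Any.here refl) = ⊥-elim (Kw Kc)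
    ∈-tail-outsideBlock Kc Kw (Any.there w∈l) = w∈l

    firstRowOutsideBlock : {c w : Outcome n} {l : List (Outcome n)} →
      Linked Adjacent (c ∷ l) → All (r₀ ≢_) l → r₀ ≢ c → K c ≡ K r₀ →
      w List.∈ l → K w ≢ K r₀ →
      ∃ λ y → K y ≢ K r₀ × R y ≢ R r₀ × ∃ λ l′ → block S y (c ∷ l) ≡ y ∷ l′
    firstRowOutsideBlock {l = d ∷ l} (_ ∷ linked) (r₀≢d ∷ distinct) r₀≢c Kc w∈ Kw
      with ≡-dec Bool._≟_ (K d) (K r₀)
    ... | yes Kd with firstRowOutsideBlock linked distinct r₀≢d Kd (∈-tail-outsideBlock Kd Kw w∈) Kw
    ...   | y , Ky , Ry , l′ , blk =
      y , Ky , Ry , l′ , trans (block-reject (λ e → Ky (trans e Kc))) blk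
    firstRowOutsideBlock {l = d ∷ l} (c~d ∷ _) _ r₀≢c Kc _ _ | no Kd =
      d , Kd , Rd≢Rr₀ , block S d l ,
      trans (block-reject (λ e → Kd (trans e Kc))) (block-accept refl)
      where
      Rd≢Rr₀ : R d ≢ R r₀
      Rd≢Rr₀ Rd with adjacent⇒restrict≡⊎restrict∁≡ S c~d
      ... | inj₁ Rc≡Rd = r₀≢c (restrict-injective S (sym (trans Rc≡Rd Rd)) (sym Kc))
      ... | inj₂ Kc≡Kd = Kd (trans (sym Kc≡Kd) Kc)

    firstStepInBlock⇒¬separable : {r₁ : Outcome n} {rest : List (Outcome n)} →
      Linked Adjacent (r₀ ∷ r₁ ∷ rest) → Unique (r₀ ∷ r₁ ∷ rest) →
      ((v : Outcome n) → v List.∈ r₀ ∷ r₁ ∷ rest) → Nonempty (∁ S) →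
      K r₀ ≡ K r₁ → ¬ SeparableRows S (r₀ ∷ r₁ ∷ rest)
    firstStepInBlock⇒¬separable {r₁} {rest} (_ ∷ linked) ((r₀≢r₁ ∷ distinct) ∷ _)
                                complete (j , j∈∁S) K₀≡K₁ separable
      with firstRowOutsideBlock linked distinct r₀≢r₁ (sym K₀≡K₁) w∈rest Kw≢Kr₀
      where
      w : Outcome n
      w = flipAt r₀ j
      Kw≢Kr₀ : K w ≢ K r₀
      Kw≢Kr₀ = restrict-flipAt r₀ j∈∁S ∘ sym
      w∈rest : w List.∈ rest
      w∈rest = ∈-tail-outsideBlock (sym K₀≡K₁) Kw≢Kr₀
                 (∈-tail-outsideBlock refl Kw≢Kr₀ (complete w))
    ... | y , Ky≢Kr₀ , Ry≢Rr₀ , l′ , block-y = Ry≢Rr₀ (sym (∷-injectiveˡ heads))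
      where
      open ≡-Reasoning
      heads : R r₀ ∷ map R (block S r₀ (r₁ ∷ rest)) ≡ R y ∷ map R l′
      heads = begin
        R r₀ ∷ map R (block S r₀ (r₁ ∷ rest))  ≡⟨ cong (map R) (block-accept refl) ⟨
        map R (block S r₀ (r₀ ∷ r₁ ∷ rest))    ≡⟨ separable r₀ y ⟩
        map R (block S y (r₀ ∷ r₁ ∷ rest))     ≡⟨ cong (map R) (block-reject Ky≢Kr₀) ⟩
        map R (block S y (r₁ ∷ rest))          ≡⟨ cong (map R) block-y ⟩
        R y ∷ map R l′                         ∎

¬bothSeparable : (S : Subset n) {rs : List (Outcome n)} →
  Linked Adjacent rs → Unique rs → ((v : Outcome n) → v List.∈ rs) →
  Nonempty S → Nonempty (∁ S) → ¬ (SeparableRows S rs × SeparableRows (∁ S) rs)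
¬bothSeparable S {[]} _ _ complete _ _ _ with complete (replicate _ false)
... | ()
¬bothSeparable S {r₀ ∷ []} _ _ complete (i , i∈S) _ _ with complete (flipAt r₀ i)
... | Any.here w≡r₀ = restrict-flipAt r₀ i∈S (cong (restrict S) (sym w≡r₀))
¬bothSeparable S {r₀ ∷ r₁ ∷ _} linked unique complete nonempty nonempty∁ (separable , separable∁)
  with adjacent⇒restrict≡⊎restrict∁≡ S (Linked.head linked)
... | inj₂ K₀≡K₁ =
  firstStepInBlock⇒¬separable S r₀ linked unique complete nonempty∁ K₀≡K₁ separable
... | inj₁ R₀≡R₁ =
  firstStepInBlock⇒¬separable (∁ S) r₀ linked unique complete
    (subst Nonempty (sym (∁-involutive S)) nonempty)
    (subst (λ T → restrict T r₀ ≡ restrict T r₁) (sym (∁-involutive S)) R₀≡R₁)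
    separable∁

-- The hypothesis 1 ≤ n is implied by Nonempty S.
corollary1 : (n : ℕ) → 1 ≤ n → (P : PrefMatrix n) → InCG P →
    (S : Subset n) → Nonempty S → Nonempty (∁ S) →
    ¬ (Separable S P × Separable (∁ S) P)
corollary1 n _ P inCG S nonempty nonempty∁ =
  ¬bothSeparable S inCG (unique P) (complete P) nonempty nonempty∁
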